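{- Let $G=(V_G,E_G)$ be a hypergraph with $V_G=\{0,1,\dots,p\}\subset\mathbb{N}_0$ and $E_G$ a finite (multi)collection of nonempty subsets of $V_G$. Write each edge as the tuple of its nodes in strictly ascending order, order the edges in descending lexicographic order (a proper prefix of a tuple being lexicographically smaller than the tuple), and let $T$ be the concatenation of these tuples in that order, a string of length $M_G=\sum_{e\in E_G}|e|$; thus each edge occupies a block of consecutive positions $k,k+1,\dots,k+r-1$ of $T$. Let $SA$ be the suffix array of $T$ and $SA^{ -1}$ its inverse. Define the permutation $\Psi$ of $\{0,\dots,M_G-1\}$ by: if $SA[i]$ is not the last position of its edge block, $\Psi[i]=SA^{ -1}[SA[i]+1]$; if $SA[i]$ is the last position of the edge block starting at position $k$, $\Psi[i]=SA^{ -1}[k]$. Then the sequence $\Psi[0],\Psi[1],\dots,\Psi[M_G-1]$ is a concatenation of at most $|V_G|$ contiguous strictly increasing subsequences.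
   Context: For a string $T$ of length $n$, $T[i..]$ is the suffix starting at position $i$; the suffix array $SA$ is the permutation of $\{0,\dots,n-1\}$ such that $T[SA[0]..]<T[SA[1]..]<\cdots<T[SA[n-1]..]$ in lexicographic order (a proper prefix being smaller). The collection $E_G$ may contain repeated edges; each edge contains each node once. With this definition, repeated application of $\Psi$ starting from a suffix-array position cycles through the suffix-array positions of the nodes of exactly one edge. -}

module Defs where

open import Data.Nat using (ℕ; zero; suc; _+_; _∸_; _<_; _≤_; _<ᵇ_)
open import Data.Bool using (if_then_else_)
open import Data.List using (List; []; _∷_; length; concat; drop; map)
open import Data.Nat.ListAction using (sum)
open import Data.List.Relation.Unary.All using (All)
open import Data.List.Relation.Unary.Linked using (Linked)
open import Data.List.Relation.Binary.Lex.Core using (Lex-<; Lex-≤)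
open import Relation.Binary.PropositionalEquality using (_≡_)

_<ₗ_ : List ℕ → List ℕ → Set
_<ₗ_ = Lex-< _≡_ _<_

_≤ₗ_ : List ℕ → List ℕ → Set
_≤ₗ_ = Lex-≤ _≡_ _<_

record IsEdge (p : ℕ) (e : List ℕ) : Set where
  field
    nonempty   : 0 < length e
    ascending  : Linked _<_ e
    nodesInVG  : All (_≤ p) e

-- The edge collection E_G written as a list of tuples in descending
-- lexicographic order (repeated edges allowed, hence non-strict).
record IsSortedEdgeList (p : ℕ) (es : List (List ℕ)) : Set where
  field
    edges      : All (IsEdge p) es
    descending : Linked (λ e f → f ≤ₗ e) es

text : List (List ℕ) → List ℕ
text = concat

totalSize : List (List ℕ) → ℕ
totalSize es = sum (map length es)

suffix : List ℕ → ℕ → List ℕ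
suffix T i = drop i T

record IsSuffixArray (T : List ℕ) (SA SAinv : ℕ → ℕ) : Set where
  field
    SA-range    : ∀ i → i < length T → SA i < length T
    SAinv-range : ∀ x → x < length T → SAinv x < length T
    left-inv    : ∀ i → i < length T → SAinv (SA i) ≡ i
    right-inv   : ∀ x → x < length T → SA (SAinv x) ≡ x
    sorted      : ∀ i j → i < j → j < length T →
                  suffix T (SA i) <ₗ suffix T (SA j)

-- Cyclic successor of a text position within its edge block:
-- x+1 if x is not the last position of its block, otherwise the block start k.
-- (Positions ≥ M_G are mapped arbitrarily; they never occur.)
blockSucc : List (List ℕ) → ℕ → ℕ
blockSucc []       x = x
blockSucc (e ∷ es) x =
  if x <ᵇ length e
  then (if suc x <ᵇ length e then suc x else 0)
  else length e + blockSucc es (x ∸ length e)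

Ψ : List (List ℕ) → (ℕ → ℕ) → (ℕ → ℕ) → ℕ → ℕ
Ψ es SA SAinv i = SAinv (blockSucc es (SA i))

{-# OPTIONS --safe #-}
module Submission where

-- Adjacent rows of the suffix array have suffixes c₁ ∷ t₁ < c₂ ∷ t₂, so c₁ ≤ c₂; as all
-- symbols are ≤ p, the first symbol increases at most p times along the array, and it
-- suffices to show Ψ[i] < Ψ[i+1] when c₁ = c₂ (so t₁ < t₂).  For a position that is not
-- last in its block, the suffix at its block successor is its tail.  For the last
-- position of block j, the tail is the suffix B(j+1) starting at block j+1 and the
-- successor suffix is B(j).  Since edges are ascending and sorted in descending order,
-- B(0) > B(1) > ⋯, and the tail of a last position starts with a symbol ≤ c while any
-- other tail starts with a symbol > c; so in each of the four cases the order of the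
-- tails carries over to the successor suffixes.

open import Defs
open import Data.Bool using (true; false)
open import Data.Bool.Properties using (T-≡; ¬-not)
open import Data.Empty using (⊥-elim)
open import Data.List using (List; []; _∷_; [_]; _++_; length; concat; map; drop; upTo; applyUpTo)
open import Data.List.Properties using (length-++; length-++-≤ˡ; map-upTo; map-applyUpTo)
open import Data.List.Relation.Binary.Lex.Core using (base; halt; this; next)
import Data.List.Relation.Binary.Lex.Strict as Lex
import Data.List.Relation.Binary.Pointwise as Pointwise
open import Data.List.Relation.Unary.All using (All; []; _∷_)
import Data.List.Relation.Unary.All as All
open import Data.List.Relation.Unary.All.Properties using (drop⁺; concat⁺; applyUpTo⁺₁)
import Data.List.Relation.Unary.AllPairs as AllPairs
open import Data.List.Relation.Unary.Linked using (Linked; []; [-]; _∷_)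
import Data.List.Relation.Unary.Linked as Linked
import Data.List.Relation.Unary.Linked.Properties as Linked
open import Data.List.Relation.Unary.Linked.Properties using (Linked⇒AllPairs)
open import Data.Nat using (ℕ; zero; suc; _+_; _∸_; _<_; _≤_; _<ᵇ_; z≤n; s≤s; z<s; s<s)
open import Data.Nat.Properties
open import Data.Product using (Σ; _×_; _,_; proj₁; proj₂)
open import Data.Product.Relation.Binary.Lex.Strict using (×-Lex)
open import Data.Sum using (inj₁; inj₂)
open import Function.Base using (_∘_)
open import Function.Bundles using (Equivalence)
open import Relation.Binary.Definitions using (tri<; tri≈; tri>)
open import Relation.Binary.PropositionalEquality
  using (_≡_; refl; sym; trans; cong; subst; subst₂; module ≡-Reasoning)
open import Relation.Binary.Structures using (IsStrictTotalOrder)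
open import Relation.Nullary using (¬_; contradiction)

private variable
  p b c d i u v x : ℕ
  SA SAinv : ℕ → ℕ
  e t s₁ s₂ t₁ t₂ T xs ys : List ℕ
  es : List (List ℕ)

private
  module <ₗ = IsStrictTotalOrder (Lex.<-isStrictTotalOrder <-isStrictTotalOrder)

<ₗ-irrefl : ¬ (xs <ₗ xs)
<ₗ-irrefl = <ₗ.irrefl (Pointwise.refl refl)

∷-≤ₗ-∷⇒≤ : ∀ {x y} → (x ∷ xs) ≤ₗ (y ∷ ys) → x ≤ y
∷-≤ₗ-∷⇒≤ (this x<y)     = <⇒≤ x<y
∷-≤ₗ-∷⇒≤ (next refl _) = ≤-refl

drop-nonempty : x < length xs → Σ ℕ λ c → Σ (List ℕ) λ t → drop x xs ≡ c ∷ t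
drop-nonempty {zero}  {_ ∷ _}  _          = _ , _ , refl
drop-nonempty {suc x} {_ ∷ xs} (s<s x<n) = drop-nonempty {x} {xs} x<n

drop-suc : drop x xs ≡ c ∷ t → drop (suc x) xs ≡ t
drop-suc {zero}  refl = refl
drop-suc {suc x} {_ ∷ xs} eq = drop-suc {x} {xs} eq

drop-++ˡ : x ≤ length xs → drop x (xs ++ ys) ≡ drop x xs ++ ys
drop-++ˡ {zero}  _         = refl
drop-++ˡ {suc x} {_ ∷ xs} (s≤s x≤n) = drop-++ˡ {x} {xs} x≤n

drop-++ʳ : length xs ≤ x → drop x (xs ++ ys) ≡ drop (x ∸ length xs) ys
drop-++ʳ {[]}     _         = refl
drop-++ʳ {_ ∷ xs} {suc x} (s≤s n≤x) = drop-++ʳ {xs} {x} n≤x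

drop-length-++ : ∀ xs → drop (length xs + x) (xs ++ ys) ≡ drop x ys
drop-length-++ []       = refl
drop-length-++ (_ ∷ xs) = drop-length-++ xs

data Head≤ (b : ℕ) : List ℕ → Set where
  []    : Head≤ b []
  head≤ : ∀ {x xs} → x ≤ b → Head≤ b (x ∷ xs)

Head≤-<ₗ : Head≤ b xs → b < d → xs <ₗ (d ∷ ys)
Head≤-<ₗ []          _   = halt
Head≤-<ₗ (head≤ x≤b) b<d = this (≤-<-trans x≤b b<d)

Head≤-++ : Head≤ b xs → Head≤ b ys → Head≤ b (xs ++ ys)
Head≤-++ []          h = h
Head≤-++ (head≤ x≤b) _ = head≤ x≤b

drop-ascending : Linked _<_ xs → suc x < length xs →
                 Σ ℕ λ c → Σ ℕ λ d → Σ (List ℕ) λ r → drop x xs ≡ c ∷ d ∷ r × c < d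
drop-ascending {_ ∷ _ ∷ _} {zero}  (c<d ∷ _) _          = _ , _ , _ , refl , c<d
drop-ascending {_ ∷ xs}    {suc x} asc       (s<s sx<n) = drop-ascending (Linked.tail asc) sx<n

drop-last : Linked _<_ xs → suc x ≡ length xs → Σ ℕ λ c → drop x xs ≡ [ c ] × Head≤ c xs
drop-last {_ ∷ []}        {zero}  _           _  = _ , refl , head≤ ≤-refl
drop-last {_ ∷ _ ∷ _}     {suc x} (a<b ∷ asc) eq with drop-last asc (suc-injective eq)
... | c , eq′ , head≤ b≤c = c , eq′ , head≤ (≤-trans (<⇒≤ a<b) b≤c)

IncreasingRuns : ℕ → List ℕ → Set
IncreasingRuns m xs =
  Σ (List (List ℕ)) λ runs → (concat runs ≡ xs) × (length runs ≤ m) × All (Linked _<_) runs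

private
  _≺_ : ℕ × ℕ → ℕ × ℕ → Set
  _≺_ = ×-Lex _≡_ _<_ _<_

  runs-from : ∀ k x zs → Linked _≺_ ((k , x) ∷ zs) → All ((_≤ p) ∘ proj₁) ((k , x) ∷ zs) →
    Σ (List ℕ) λ run → Σ (List (List ℕ)) λ runs →
      (run ++ concat runs ≡ map proj₂ zs) × Linked _<_ (x ∷ run) × All (Linked _<_) runs ×
      (length runs + k ≤ p)
  runs-from k x [] _ (k≤p ∷ []) = [] , [] , refl , [-] , [] , k≤p
  runs-from k x ((k′ , x′) ∷ zs) (x≺x′ ∷ linked) (_ ∷ bounded)
    with runs-from k′ x′ zs linked bounded
  ... | run , runs , eq , inc , incs , bound with x≺x′
  ...   | inj₂ (refl , x<x′) = x′ ∷ run , runs , cong (x′ ∷_) eq , x<x′ ∷ inc , incs , bound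
  ...   | inj₁ k<k′ =
    [] , (x′ ∷ run) ∷ runs , cong (x′ ∷_) eq , [-] , inc ∷ incs ,
    <-≤-trans (+-monoʳ-< (length runs) k<k′) bound

×-Lex-linked⇒increasingRuns : ∀ zs → Linked _≺_ zs → All ((_≤ p) ∘ proj₁) zs →
                              IncreasingRuns (suc p) (map proj₂ zs)
×-Lex-linked⇒increasingRuns [] _ _ = [] , refl , z≤n , []
×-Lex-linked⇒increasingRuns ((k , x) ∷ zs) linked bounded with runs-from k x zs linked bounded
... | run , runs , eq , inc , incs , bound =
  (x ∷ run) ∷ runs , cong (x ∷_) eq , s≤s (≤-trans (m≤m+n _ k) bound) , inc ∷ incs

Descending : List (List ℕ) → Set
Descending = Linked (λ e f → f ≤ₗ e)

Head≤-concat : Descending (e ∷ es) → Head≤ b e → Head≤ b (concat es)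
Head≤-concat {es = []}            _           _           = []
Head≤-concat {es = [] ∷ _}        (_ ∷ desc)  _           = Head≤-concat desc []
Head≤-concat {es = (_ ∷ _) ∷ _}   (() ∷ _)    []
Head≤-concat {es = (_ ∷ _) ∷ _}   (f≤e ∷ _)   (head≤ y≤b) = head≤ (≤-trans (∷-≤ₗ-∷⇒≤ f≤e) y≤b)

¬IsEdge-[] : ¬ IsEdge p []
¬IsEdge-[] record { nonempty = () }

ascending⇒head< : Linked _<_ (x ∷ xs) → All (x <_) xs
ascending⇒head< = AllPairs.head ∘ Linked⇒AllPairs <-trans

open IsSortedEdgeList

sorted-tail : IsSortedEdgeList p (e ∷ es) → IsSortedEdgeList p es
sorted-tail G = record { edges = All.tail (edges G) ; descending = Linked.tail (descending G) }

++-<ₗ-++ : ∀ {X Y} f e → f ≤ₗ e → All (b <_) e → Head≤ b X → (f ≡ e → X <ₗ Y) →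
           (f ++ X) <ₗ (e ++ Y)
++-<ₗ-++ []      []      (base _)        _         _  X<Y = X<Y refl
++-<ₗ-++ []      (_ ∷ _) halt            (b<y ∷ _) hX _   = Head≤-<ₗ hX b<y
++-<ₗ-++ (_ ∷ _) (_ ∷ _) (this x<y)      _         _  _   = this x<y
++-<ₗ-++ (x ∷ f) (_ ∷ e) (next refl f≤e) (_ ∷ b<e) hX X<Y =
  next refl (++-<ₗ-++ f e f≤e b<e hX (X<Y ∘ cong (x ∷_)))

-- If the next edge f is a proper prefix of e, the text after f continues with a symbol
-- ≤ head f, below the symbol of e at that point; if f = e, recurse on the tail.
concat-<ₗ-∷ : IsSortedEdgeList p (e ∷ es) → concat es <ₗ concat (e ∷ es)
concat-<ₗ-∷ {e = []} G = ⊥-elim (¬IsEdge-[] (All.head (edges G)))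
concat-<ₗ-∷ {e = _ ∷ _} {es = []} _ = halt
concat-<ₗ-∷ {e = _ ∷ _} {es = [] ∷ _} G = ⊥-elim (¬IsEdge-[] (All.head (All.tail (edges G))))
concat-<ₗ-∷ {e = y ∷ e} {es = (_ ∷ f) ∷ _} G with descending G
... | this x<y ∷ _ = this x<y
... | next refl f≤e ∷ desc =
  next refl (++-<ₗ-++ f e f≤e (ascending⇒head< (IsEdge.ascending (All.head (edges G))))
                      (Head≤-concat desc (head≤ ≤-refl))
                      λ { refl → concat-<ₗ-∷ (sorted-tail G) })

blockSuffix : ℕ → List (List ℕ) → List ℕ
blockSuffix j es = concat (drop j es)

blockSuffix-<ₗ : IsSortedEdgeList p es → ∀ {i j} → i < j → j ≤ length es →
                 blockSuffix j es <ₗ blockSuffix i es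
blockSuffix-<ₗ {es = _ ∷ _} G {zero} {suc zero} _ _ = concat-<ₗ-∷ G
blockSuffix-<ₗ {es = _ ∷ _} G {zero} {suc (suc j)} _ (s≤s j<n) =
  <ₗ.trans (blockSuffix-<ₗ (sorted-tail G) {zero} {suc j} z<s j<n) (concat-<ₗ-∷ G)
blockSuffix-<ₗ {es = _ ∷ _} G {suc i} {suc j} (s<s i<j) (s≤s j≤n) =
  blockSuffix-<ₗ (sorted-tail G) i<j j≤n

<ᵇ-true : x < d → (x <ᵇ d) ≡ true
<ᵇ-true = Equivalence.to T-≡ ∘ <⇒<ᵇ

<ᵇ-false : ¬ x < d → (x <ᵇ d) ≡ false
<ᵇ-false {x} {d} x≮d = ¬-not (x≮d ∘ <ᵇ⇒< x d ∘ Equivalence.from T-≡)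

blockSucc-within : suc x < length e → blockSucc (e ∷ es) x ≡ suc x
blockSucc-within {x} sx<n rewrite <ᵇ-true (<-trans (n<1+n x) sx<n) | <ᵇ-true sx<n = refl

blockSucc-wrap : suc x ≡ length e → blockSucc (e ∷ es) x ≡ 0
blockSucc-wrap {x} sx≡n
  rewrite <ᵇ-true (subst (x <_) sx≡n (n<1+n x)) | <ᵇ-false (<-irrefl sx≡n) = refl

blockSucc-later : length e ≤ x → blockSucc (e ∷ es) x ≡ length e + blockSucc es (x ∸ length e)
blockSucc-later n≤x rewrite <ᵇ-false (≤⇒≯ n≤x) = refl

blockSucc-< : x < length (text es) → blockSucc es x < length (text es)
blockSucc-< {x = x} {es = e ∷ es} x<n with <-cmp (suc x) (length e)
... | tri< sx<e _ _ rewrite blockSucc-within {e = e} {es = es} sx<e = ≤-trans sx<e (length-++-≤ˡ e)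
... | tri≈ _ sx≡e _ rewrite blockSucc-wrap {e = e} {es = es} sx≡e = ≤-<-trans z≤n x<n
... | tri> _ _ e<sx
  rewrite blockSucc-later {e = e} {es = es} (≤-pred e<sx) | length-++ e {text es} =
  +-monoʳ-< (length e) (blockSucc-< {es = es} x∸e<n)
  where
  x∸e<n : x ∸ length e < length (text es)
  x∸e<n = subst (x ∸ length e <_) (m+n∸m≡n (length e) _) (∸-monoˡ-< x<n (≤-pred e<sx))

-- BlockStep es c t s: some position of text es holds c followed by t, and s is
-- the suffix of text es at the blockSucc of that position; in the wrap case the
-- position is the last one of block j.
data BlockStep (es : List (List ℕ)) (c : ℕ) : List ℕ → List ℕ → Set where
  within : ∀ {d r} → c < d → BlockStep es c (d ∷ r) (d ∷ r)
  wrap   : ∀ j → j < length es →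
           Head≤ c (blockSuffix (suc j) es) → Head≤ c (blockSuffix j es) →
           BlockStep es c (blockSuffix (suc j) es) (blockSuffix j es)

BlockStep-∷ : BlockStep es c t₁ s₁ → BlockStep (e ∷ es) c t₁ s₁
BlockStep-∷ (within c<d)         = within c<d
BlockStep-∷ (wrap j j<n hₜ hₛ) = wrap (suc j) (s<s j<n) hₜ hₛ

BlockStep-mono : IsSortedEdgeList p es →
                 BlockStep es c t₁ s₁ → BlockStep es c t₂ s₂ → t₁ <ₗ t₂ → s₁ <ₗ s₂
BlockStep-mono _ (within _)         (within _)         t₁<t₂ = t₁<t₂
BlockStep-mono _ (within c<d)       (wrap _ _ hₜ _)    t₁<t₂ =
  contradiction (Head≤-<ₗ hₜ c<d) (<ₗ.asym t₁<t₂)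
BlockStep-mono _ (wrap _ _ _ hₛ)    (within c<d)       _     = Head≤-<ₗ hₛ c<d
BlockStep-mono G (wrap i i<n _ _)   (wrap j j<n _ _)   t₁<t₂ with <-cmp i j
... | tri< i<j _ _ = contradiction (blockSuffix-<ₗ G (s<s i<j) j<n) (<ₗ.asym t₁<t₂)
... | tri≈ _ refl _ = contradiction t₁<t₂ <ₗ-irrefl
... | tri> _ _ j<i = blockSuffix-<ₗ G j<i (<⇒≤ i<n)

blockStep-within : IsEdge p e → suc x < length e → suffix (text (e ∷ es)) x ≡ c ∷ t →
                   BlockStep (e ∷ es) c t (suffix (text (e ∷ es)) (blockSucc (e ∷ es) x))
blockStep-within {e = e} {x = x} {es = es} ie sx<e eq with drop-ascending (IsEdge.ascending ie) sx<e
... | _ , d , r , eqₓ , c<d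
  with trans (sym eq) (trans (drop-++ˡ {xs = e} (<⇒≤ (<-trans (n<1+n x) sx<e)))
                             (cong (_++ text es) eqₓ))
...   | refl = subst (BlockStep (e ∷ es) _ _) (sym successor) (within c<d)
  where
  open ≡-Reasoning
  successor : suffix (text (e ∷ es)) (blockSucc (e ∷ es) x) ≡ d ∷ r ++ text es
  successor = begin
    drop (blockSucc (e ∷ es) x) (e ++ text es)
      ≡⟨ cong (λ y → drop y (e ++ text es)) (blockSucc-within {e = e} {es = es} sx<e) ⟩
    drop (suc x) (e ++ text es)
      ≡⟨ drop-++ˡ {xs = e} (<⇒≤ sx<e) ⟩
    drop (suc x) e ++ text es
      ≡⟨ cong (_++ text es) (drop-suc {xs = e} eqₓ) ⟩
    d ∷ r ++ text es
      ∎

blockStep-wrap : IsSortedEdgeList p (e ∷ es) → suc x ≡ length e → suffix (text (e ∷ es)) x ≡ c ∷ t →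
                 BlockStep (e ∷ es) c t (suffix (text (e ∷ es)) (blockSucc (e ∷ es) x))
blockStep-wrap {e = e} {es = es} {x = x} G sx≡e eq
  with drop-last (IsEdge.ascending (All.head (edges G))) sx≡e
... | c , eqₓ , c≥e
  with trans (sym eq) (trans (drop-++ˡ {xs = e} (≤-trans (n≤1+n x) (≤-reflexive sx≡e)))
                             (cong (_++ text es) eqₓ))
...   | refl = subst (BlockStep (e ∷ es) c (text es))
                     (cong (λ y → drop y (e ++ text es))
                           (sym (blockSucc-wrap {e = e} {es = es} sx≡e)))
                     (wrap 0 z<s c≥es (Head≤-++ c≥e c≥es))
  where
  c≥es : Head≤ c (text es)
  c≥es = Head≤-concat (descending G) c≥e

blockStep : IsSortedEdgeList p es → suffix (text es) x ≡ c ∷ t →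
            BlockStep es c t (suffix (text es) (blockSucc es x))
blockStep {es = []} {x = zero}  _ ()
blockStep {es = []} {x = suc _} _ ()
blockStep {es = e ∷ es} {x = x} G eq with <-cmp (suc x) (length e)
... | tri< sx<e _ _ = blockStep-within (All.head (edges G)) sx<e eq
... | tri≈ _ sx≡e _ = blockStep-wrap G sx≡e eq
... | tri> _ _ e<sx =
  subst (BlockStep (e ∷ es) _ _) (sym successor)
        (BlockStep-∷ (blockStep (sorted-tail G) (trans (sym (drop-++ʳ {xs = e} e≤x)) eq)))
  where
  e≤x : length e ≤ x
  e≤x = ≤-pred e<sx
  successor : suffix (text (e ∷ es)) (blockSucc (e ∷ es) x) ≡
              suffix (text es) (blockSucc es (x ∸ length e))
  successor = trans (cong (λ y → drop y (e ++ text es)) (blockSucc-later {e = e} {es = es} e≤x))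
                    (drop-length-++ e)

module _ (sa : IsSuffixArray T SA SAinv) where
  open IsSuffixArray sa

  SAinv-mono : u < length T → v < length T → suffix T u <ₗ suffix T v → SAinv u < SAinv v
  SAinv-mono {u} {v} u<n v<n Tᵤ<Tᵥ with <-cmp (SAinv u) (SAinv v)
  ... | tri< lt _ _ = lt
  ... | tri≈ _ eq _ = contradiction (subst (λ w → suffix T w <ₗ suffix T v) u≡v Tᵤ<Tᵥ) <ₗ-irrefl
    where
    u≡v : u ≡ v
    u≡v = trans (sym (right-inv u u<n)) (trans (cong SA eq) (right-inv v v<n))
  ... | tri> _ _ gt =
    contradiction (subst₂ (λ x y → suffix T x <ₗ suffix T y) (right-inv v v<n) (right-inv u u<n)
                          (sorted (SAinv v) (SAinv u) gt (SAinv-range u u<n)))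
                  (<ₗ.asym Tᵤ<Tᵥ)

firstSymbol : List ℕ → ℕ
firstSymbol []      = 0
firstSymbol (c ∷ _) = c

firstSymbol-≤ : All (_≤ p) xs → firstSymbol xs ≤ p
firstSymbol-≤ []         = z≤n
firstSymbol-≤ (c≤p ∷ _) = c≤p

length-text : ∀ es → length (text es) ≡ totalSize es
length-text []       = refl
length-text (e ∷ es) = trans (length-++ e) (cong (length e +_) (length-text es))

module _ (G : IsSortedEdgeList p es) (sa : IsSuffixArray (text es) SA SAinv) where
  open IsSuffixArray sa

  symbolRank : ℕ → ℕ × ℕ
  symbolRank x = firstSymbol (suffix (text es) x) , SAinv (blockSucc es x)

  symbolRank-≺ : u < length (text es) → v < length (text es) →
                 suffix (text es) u <ₗ suffix (text es) v → symbolRank u ≺ symbolRank v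
  symbolRank-≺ u<n v<n Tᵤ<Tᵥ with drop-nonempty u<n | drop-nonempty v<n
  ... | c₁ , t₁ , eq₁ | c₂ , t₂ , eq₂ with subst₂ _<ₗ_ eq₁ eq₂ Tᵤ<Tᵥ
  ... | this c₁<c₂ =
    inj₁ (subst₂ _<_ (cong firstSymbol (sym eq₁)) (cong firstSymbol (sym eq₂)) c₁<c₂)
  ... | next refl t₁<t₂ =
    inj₂ ( trans (cong firstSymbol eq₁) (cong firstSymbol (sym eq₂))
         , SAinv-mono sa (blockSucc-< {es = es} u<n) (blockSucc-< {es = es} v<n)
                         (BlockStep-mono G (blockStep G eq₁) (blockStep G eq₂) t₁<t₂) )

  symbolRank-SA-≺ : suc i < length (text es) → symbolRank (SA i) ≺ symbolRank (SA (suc i))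
  symbolRank-SA-≺ {i} si<n =
    symbolRank-≺ (SA-range i (<-trans (n<1+n i) si<n)) (SA-range (suc i) si<n)
                 (sorted i (suc i) (n<1+n i) si<n)

  firstSymbol-≤ₚ : ∀ x → firstSymbol (suffix (text es) x) ≤ p
  firstSymbol-≤ₚ x = firstSymbol-≤ (drop⁺ x (concat⁺ (All.map IsEdge.nodesInVG (edges G))))

theorem2 : (p : ℕ) (es : List (List ℕ)) → IsSortedEdgeList p es →
    (SA SAinv : ℕ → ℕ) → IsSuffixArray (text es) SA SAinv →
    Σ (List (List ℕ)) λ runs →
      (concat runs ≡ map (Ψ es SA SAinv) (upTo (totalSize es)))
      × (length runs ≤ suc p)
      × All (Linked _<_) runs
theorem2 p es G SA SAinv sa =
  subst (IncreasingRuns (suc p)) Ψ-values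
    (×-Lex-linked⇒increasingRuns (applyUpTo rows n)
      (Linked.applyUpTo⁺₁ rows n (symbolRank-SA-≺ G sa))
      (applyUpTo⁺₁ rows n (λ {i} _ → firstSymbol-≤ₚ G sa (SA i))))
  where
  n : ℕ
  n = length (text es)
  rows : ℕ → ℕ × ℕ
  rows i = symbolRank G sa (SA i)
  open ≡-Reasoning
  Ψ-values : map proj₂ (applyUpTo rows n) ≡ map (Ψ es SA SAinv) (upTo (totalSize es))
  Ψ-values = begin
    map proj₂ (applyUpTo rows n)               ≡⟨ map-applyUpTo rows proj₂ n ⟩
    applyUpTo (Ψ es SA SAinv) n                ≡⟨ map-upTo (Ψ es SA SAinv) n ⟨
    map (Ψ es SA SAinv) (upTo n)               ≡⟨ cong (map (Ψ es SA SAinv) ∘ upTo) (length-text es) ⟩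
    map (Ψ es SA SAinv) (upTo (totalSize es))  ∎
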